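{- Let $P\in\mathbb{Z}[a,z_1,\dots,z_\nu]$ be suitable for coding and define $\mathfrak b,\mathcal X,\mathcal Y$ as in the context. Then for all integers $a\ge0$, $f>0$, $g\ge0$: \[ \mathcal X(a,f,g)\ge 3\,\mathfrak b(a,f),\qquad \mathcal Y(a,f)\ge\max\{\mathfrak b(a,f),2^8\}. \]
   Context: A polynomial $P(a,z_1,\dots,z_\nu)$ with integer coefficients is suitable for coding if: (i) whenever $P(a,\mathbf z)=0$ with $(a,\mathbf z)\in\mathbb{N}^{\nu+1}$, there is $\mathbf z'\in\mathbb{N}^\nu$ with $P(a,\mathbf z')=0$ and some $z'_i>0$; (ii) its constant coefficient is positive; (iii) its degree is positive. Write $P=\sum_{\mathbf i\in\mathbb{N}^{\nu+1},\|\mathbf i\|\le\delta}a_{\mathbf i}X_0^{i_0}\cdots X_\nu^{i_\nu}$ (with $X_0=a$, $X_j=z_j$), of total degree $\delta$, where $\|\mathbf i\|=\sum_s i_s$ and $\mathbf i!=\prod_s i_s!$. Put $\mathcal L=\sum_{\mathbf i}|a_{\mathbf i}|$, let $r\in\mathbb{N}$ be minimal with $\beta:=4^r>2\,\delta!\,\mathcal L\,(\nu+2)^\delta$, and set $n_j=(\delta+1)^j$. $\mathrm{coeffs}(Y)=\sum_{\|\mathbf i\|\le\delta}\mathbf i!\,(\delta-\|\mathbf i\|)!\,a_{\mathbf i}\,Y^{(\delta+1)^{\nu+1}-\sum_{s=0}^{\nu}i_s(\delta+1)^s}$; $\mathrm{values}(x,\mathscr B)=x^\delta\,\mathrm{coeffs}(\mathscr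 B)+\sum_{j=0}^{(2\delta+1)(\delta+1)^\nu}\frac{\mathscr B}{2}\mathscr B^{j}$; for integers $b<\mathscr B$, $\mathrm{mask}(b,\mathscr B)=\sum_{i=0}^{n_\nu}m_i\mathscr B^i$ with $m_i=\mathscr B-b$ if $i=n_j$ for some $j\in\{1,\dots,\nu\}$, else $m_i=\mathscr B-1$. Define: $\mathfrak b(a,f)=1+3(2a+1)f$; $\mathscr B=\beta\mathfrak b^\delta$; $M=\mathrm{mask}(\mathfrak b,\mathscr B)$; $N_0=\mathscr B^{(\delta+1)^\nu+1}$; $N_1=4\mathscr B^{(2\delta+1)(\delta+1)^\nu+1}$; $N=N_0N_1$; $c=1+a\mathscr B+g$; $\mathcal K=\mathrm{values}(c,\mathscr B)$; $\mathcal S=g+2\mathcal KN_0$; $\mathcal T=M+(\mathscr B-2)\mathscr B^{(\delta+1)^{\nu+1}}N_0$; $\mathcal R=(\mathcal S+\mathcal T+1)N+\mathcal T+1$; $\mathcal X=(N-1)\mathcal R$; $\mathcal Y=N^2$. -}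

module Defs where

open import Data.Nat as ℕ using (ℕ; zero; suc; _∸_; _⊔_; _≡ᵇ_; _!)
open import Data.Nat.Properties as ℕP using ()
open import Data.Integer as ℤ using (ℤ; +_; ∣_∣)
open import Data.Vec as Vec using (Vec; []; _∷_)
open import Data.Vec.Properties using (≡-dec)
open import Data.List as List using (List)
open import Data.Nat.ListAction using () renaming (sum to sumL)
open import Data.Bool.ListAction using () renaming (any to anyL)
open import Data.List.Relation.Unary.All using (All)
open import Data.List.Relation.Unary.Unique.Propositional using (Unique)
open import Data.Vec.Relation.Unary.Any as VAny using ()
open import Data.Product using (_×_; proj₁; proj₂; ∃)
open import Data.Bool using (Bool; if_then_else_)
open import Relation.Nullary using (¬_)
open import Relation.Nullary.Decidable using (does)
open import Relation.Binary.PropositionalEquality using (_≡_; _≢_)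

-- A polynomial in X₀ = a, X₁ = z₁, …, X_ν = z_ν with integer coefficients,
-- given as a finite list of monomials (exponent vector, coefficient).
Monomial : ℕ → Set
Monomial ν = Vec ℕ (suc ν) × ℤ

Poly : ℕ → Set
Poly ν = List (Monomial ν)

IsNormal : ∀ {ν} → Poly ν → Set
IsNormal P = Unique (List.map proj₁ P) × All (λ m → proj₂ m ≢ ℤ.0ℤ) P

norm : ∀ {n} → Vec ℕ n → ℕ
norm = Vec.sum

vfact : ∀ {n} → Vec ℕ n → ℕ
vfact v = Vec.foldr _ ℕ._*_ 1 (Vec.map _! v)

wsum : ∀ {n} → ℕ → Vec ℕ n → ℕ
wsum base [] = 0
wsum base (x ∷ xs) = x ℕ.+ base ℕ.* wsum base xs

totalDegree : ∀ {ν} → Poly ν → ℕ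
totalDegree = List.foldr (λ m d → norm (proj₁ m) ⊔ d) 0

coeffL1 : ∀ {ν} → Poly ν → ℕ
coeffL1 P = sumL (List.map (λ m → ∣ proj₂ m ∣) P)

coeff : ∀ {ν} → Poly ν → Vec ℕ (suc ν) → ℤ
coeff P e = List.foldr (λ m acc → (if does (≡-dec ℕP._≟_ e (proj₁ m)) then proj₂ m else ℤ.0ℤ) ℤ.+ acc) ℤ.0ℤ P

monEval : ∀ {n} → Vec ℕ n → Vec ℕ n → ℕ
monEval e x = Vec.foldr _ ℕ._*_ 1 (Vec.zipWith ℕ._^_ x e)

eval : ∀ {ν} → Poly ν → Vec ℕ (suc ν) → ℤ
eval P x = List.foldr (λ m acc → proj₂ m ℤ.* + monEval (proj₁ m) x ℤ.+ acc) ℤ.0ℤ P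

SuitableForCoding : ∀ {ν} → Poly ν → Set
SuitableForCoding {ν} P =
  (∀ (a : ℕ) (z : Vec ℕ ν) → eval P (a ∷ z) ≡ ℤ.0ℤ →
     ∃ λ (z′ : Vec ℕ ν) → eval P (a ∷ z′) ≡ ℤ.0ℤ × VAny.Any (λ zi → 0 ℕ.< zi) z′)
  × (ℤ.0ℤ ℤ.< coeff P (Vec.replicate (suc ν) 0))
  × (0 ℕ.< totalDegree P)

IsLeastPow4Above : ℕ → ℕ → Set
IsLeastPow4Above K r = (K ℕ.< 4 ℕ.^ r) × (∀ r′ → r′ ℕ.< r → ¬ (K ℕ.< 4 ℕ.^ r′))

betaBound : ∀ {ν} → Poly ν → ℕ
betaBound {ν} P = 2 ℕ.* (totalDegree P !) ℕ.* coeffL1 P ℕ.* ((ν ℕ.+ 2) ℕ.^ totalDegree P)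

sumTo : ℕ → (ℕ → ℕ) → ℕ
sumTo zero f = f 0
sumTo (suc n) f = sumTo n f ℕ.+ f (suc n)

module Construction {ν : ℕ} (P : Poly ν) (r : ℕ) where
  δ : ℕ
  δ = totalDegree P

  β : ℕ
  β = 4 ℕ.^ r

  nj : ℕ → ℕ
  nj j = (δ ℕ.+ 1) ℕ.^ j

  coeffs : ℕ → ℤ
  coeffs Y = List.foldr (λ m acc →
      + (vfact (proj₁ m) ℕ.* ((δ ∸ norm (proj₁ m)) !)) ℤ.* proj₂ m
        ℤ.* + (Y ℕ.^ ((δ ℕ.+ 1) ℕ.^ (ν ℕ.+ 1) ∸ wsum (δ ℕ.+ 1) (proj₁ m)))
      ℤ.+ acc) ℤ.0ℤ P

  values : ℕ → ℕ → ℤ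
  values x B = + (x ℕ.^ δ) ℤ.* coeffs B
    ℤ.+ + sumTo ((2 ℕ.* δ ℕ.+ 1) ℕ.* (δ ℕ.+ 1) ℕ.^ ν) (λ j → (B ℕ./ 2) ℕ.* B ℕ.^ j)

  isN : ℕ → Bool
  isN i = anyL (λ j → i ≡ᵇ nj j) (List.map suc (List.upTo ν))

  mask : ℕ → ℕ → ℕ
  mask b B = sumTo (nj ν) (λ i → (if isN i then B ∸ b else B ∸ 1) ℕ.* B ℕ.^ i)

  𝔟 : ℕ → ℕ → ℕ
  𝔟 a f = 1 ℕ.+ 3 ℕ.* (2 ℕ.* a ℕ.+ 1) ℕ.* f

  𝓑 : ℕ → ℕ → ℕ
  𝓑 a f = β ℕ.* 𝔟 a f ℕ.^ δ

  M : ℕ → ℕ → ℕ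
  M a f = mask (𝔟 a f) (𝓑 a f)

  N₀ N₁ N : ℕ → ℕ → ℕ
  N₀ a f = 𝓑 a f ℕ.^ ((δ ℕ.+ 1) ℕ.^ ν ℕ.+ 1)
  N₁ a f = 4 ℕ.* 𝓑 a f ℕ.^ ((2 ℕ.* δ ℕ.+ 1) ℕ.* (δ ℕ.+ 1) ℕ.^ ν ℕ.+ 1)
  N a f = N₀ a f ℕ.* N₁ a f

  c : ℕ → ℕ → ℕ → ℕ
  c a f g = 1 ℕ.+ a ℕ.* 𝓑 a f ℕ.+ g

  𝓚 : ℕ → ℕ → ℕ → ℤ
  𝓚 a f g = values (c a f g) (𝓑 a f)

  𝓢 : ℕ → ℕ → ℕ → ℤ
  𝓢 a f g = + g ℤ.+ + 2 ℤ.* 𝓚 a f g ℤ.* + N₀ a f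

  𝓣 : ℕ → ℕ → ℕ
  𝓣 a f = M a f ℕ.+ (𝓑 a f ∸ 2) ℕ.* 𝓑 a f ℕ.^ ((δ ℕ.+ 1) ℕ.^ (ν ℕ.+ 1)) ℕ.* N₀ a f

  𝓡 : ℕ → ℕ → ℕ → ℤ
  𝓡 a f g = (𝓢 a f g ℤ.+ + 𝓣 a f ℤ.+ ℤ.1ℤ) ℤ.* + N a f ℤ.+ + 𝓣 a f ℤ.+ ℤ.1ℤ

  𝓧 : ℕ → ℕ → ℕ → ℤ
  𝓧 a f g = (+ N a f ℤ.- ℤ.1ℤ) ℤ.* 𝓡 a f g

  𝓨 : ℕ → ℕ → ℕ
  𝓨 a f = N a f ℕ.^ 2

-- The only quantity in 𝓧 that could be negative is coeffs(𝓑), and there the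
-- constant monomial contributes δ! a₀ 𝓑^E with a₀ ≥ 1 (E = (δ+1)^(ν+1)),
-- while every other monomial aᵢ Xⁱ has a positive weighted degree and so contributes
-- at most δ! |aᵢ| 𝓑^(E-1); in total these are at most δ! 𝓛 𝓑^(E-1) ≤ δ! 𝓑^E because
-- 𝓛 < β ≤ 𝓑. Hence 𝓚, 𝓢 ≥ 0 and 𝓡 ≥ 1. On the other hand N ≥ 4𝓑 ≥ 4𝔟 ≥ 16, which
-- gives 𝓧 = (N - 1)𝓡 ≥ 3𝔟 and 𝓨 = N² ≥ max(𝔟, 2⁸).
module Submission where

open import Defs
open import Data.Nat as ℕ using (ℕ; zero; suc; _≤_; _<_; _⊔_; _∸_; _!; z≤n; s≤s; NonZero)
import Data.Nat.Properties as ℕP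
open import Data.Nat.Divisibility using (_∣_; ∣⇒≤; ∣-refl; ∣-trans; *-pres-∣; *-monoʳ-∣)
open import Data.Nat.Combinatorics using (k![n∸k]!∣n!)
open import Data.Integer as ℤ using (ℤ; +_; -[1+_]; ∣_∣)
import Data.Integer.Properties as ℤP
import Algebra.Properties.CommutativeSemigroup ℤP.+-commutativeSemigroup as ℤ+
import Algebra.Properties.CommutativeSemigroup ℤP.*-commutativeSemigroup as ℤ*
open import Data.Vec as Vec using (Vec; []; _∷_)
open import Data.Vec.Properties using (≡-dec)
open import Data.List using ([]; _∷_; foldr)
open import Data.List.Relation.Unary.All using (All; []; _∷_)
open import Data.Product using (_×_; _,_; proj₁; proj₂)
open import Data.Sum using (inj₁; inj₂)
open import Data.Bool using (if_then_else_)
open import Data.Empty using (⊥-elim)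
open import Relation.Nullary using (yes; no)
open import Relation.Nullary.Decidable using (does)
open import Relation.Binary.PropositionalEquality

m!*n!∣[m+n]! : ∀ m n → m ! ℕ.* n ! ∣ (m ℕ.+ n) !
m!*n!∣[m+n]! m n =
  subst (λ k → m ! ℕ.* k ! ∣ (m ℕ.+ n) !) (ℕP.m+n∸m≡n m n) (k![n∸k]!∣n! (ℕP.m≤m+n m n))

vfact∣norm! : ∀ {n} (e : Vec ℕ n) → vfact e ∣ norm e !
vfact∣norm! []       = ∣-refl
vfact∣norm! (x ∷ xs) = ∣-trans (*-monoʳ-∣ (x !) (vfact∣norm! xs)) (m!*n!∣[m+n]! x (norm xs))

multinomial-weight≤ : ∀ {n} δ (e : Vec ℕ n) → norm e ≤ δ → vfact e ℕ.* (δ ∸ norm e) ! ≤ δ !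
multinomial-weight≤ δ e e≤δ = ∣⇒≤ ⦃ δ ℕP.!≢0 ⦄ (subst (λ k → vfact e ℕ.* (δ ∸ norm e) ! ∣ k !) (ℕP.m+[n∸m]≡n e≤δ)
  (∣-trans (*-pres-∣ (vfact∣norm! e) ∣-refl) (m!*n!∣[m+n]! (norm e) (δ ∸ norm e))))

vfact-replicate-0 : ∀ n → vfact (Vec.replicate n 0) ≡ 1
vfact-replicate-0 zero    = refl
vfact-replicate-0 (suc n) = trans (ℕP.+-identityʳ _) (vfact-replicate-0 n)

norm-replicate-0 : ∀ n → norm (Vec.replicate n 0) ≡ 0
norm-replicate-0 zero    = refl
norm-replicate-0 (suc n) = norm-replicate-0 n

wsum-replicate-0 : ∀ b n → wsum b (Vec.replicate n 0) ≡ 0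
wsum-replicate-0 b zero    = refl
wsum-replicate-0 b (suc n) = trans (cong (b ℕ.*_) (wsum-replicate-0 b n)) (ℕP.*-zeroʳ b)

wsum≡0⇒replicate-0 : ∀ b .{{_ : NonZero b}} {n} (e : Vec ℕ n) → wsum b e ≡ 0 → e ≡ Vec.replicate n 0
wsum≡0⇒replicate-0 b []       _  = refl
wsum≡0⇒replicate-0 b (x ∷ xs) eq with ℕP.m+n≡0⇒m≡0 x eq | ℕP.m*n≡0⇒m≡0∨n≡0 b (ℕP.m+n≡0⇒n≡0 x eq)
... | refl | inj₁ refl = ⊥-elim (ℕ.≢-nonZero⁻¹ b refl)
... | refl | inj₂ eq′  = cong (0 ∷_) (wsum≡0⇒replicate-0 b xs eq′)

∣i∣≤n⇒0≤i+n : ∀ i n → ∣ i ∣ ≤ n → ℤ.0ℤ ℤ.≤ i ℤ.+ + n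
∣i∣≤n⇒0≤i+n (+ m)    n _   = ℤ.+≤+ z≤n
∣i∣≤n⇒0≤i+n -[1+ m ] n m<n rewrite ℤP.⊖-≥ m<n = ℤ.+≤+ z≤n

0≤+n : ∀ {n} → ℤ.0ℤ ℤ.≤ + n
0≤+n = ℤ.+≤+ z≤n

0≤i+j : ∀ {i j} → ℤ.0ℤ ℤ.≤ i → ℤ.0ℤ ℤ.≤ j → ℤ.0ℤ ℤ.≤ i ℤ.+ j
0≤i+j = ℤP.+-mono-≤

0≤i*j : ∀ {i j} → ℤ.0ℤ ℤ.≤ i → ℤ.0ℤ ℤ.≤ j → ℤ.0ℤ ℤ.≤ i ℤ.* j
0≤i*j {+ m} {+ n} _ _ = subst (ℤ.0ℤ ℤ.≤_) (ℤP.pos-* m n) (ℤ.+≤+ z≤n)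

m≤m^n : ∀ m .{{_ : NonZero m}} n → 0 < n → m ≤ m ℕ.^ n
m≤m^n m (suc n) _ = ℕP.m≤m*n m (m ℕ.^ n) ⦃ ℕP.m^n≢0 m n ⦄

module Coefficients (ν δ Y : ℕ) where

  private instance
    δ+1≢0 : NonZero (δ ℕ.+ 1)
    δ+1≢0 = ℕ.>-nonZero (ℕP.m≤n+m 1 δ)

  E : ℕ
  E = (δ ℕ.+ 1) ℕ.^ (ν ℕ.+ 1)

  -- With δ = totalDegree P, Construction.coeffs P r Y is definitionally coeffs P.
  term : Monomial ν → ℤ
  term m = + (vfact (proj₁ m) ℕ.* ((δ ∸ norm (proj₁ m)) !)) ℤ.* proj₂ m
         ℤ.* + (Y ℕ.^ (E ∸ wsum (δ ℕ.+ 1) (proj₁ m)))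

  coeffs : Poly ν → ℤ
  coeffs L = foldr (λ m acc → term m ℤ.+ acc) ℤ.0ℤ L

  𝟎 : Vec ℕ (suc ν)
  𝟎 = Vec.replicate (suc ν) 0

  -- δ! Y^E and δ! Y^(E-1): the weights of the constant and of any other monomial.
  D K : ℕ
  D = δ ! ℕ.* Y ℕ.^ E
  K = δ ! ℕ.* Y ℕ.^ (E ∸ 1)

  K*Y≡D : K ℕ.* Y ≡ D
  K*Y≡D = begin
      δ ! ℕ.* Y ℕ.^ (E ∸ 1) ℕ.* Y   ≡⟨ ℕP.*-assoc (δ !) _ Y ⟩
      δ ! ℕ.* (Y ℕ.^ (E ∸ 1) ℕ.* Y) ≡⟨ cong (δ ! ℕ.*_) (ℕP.*-comm _ Y) ⟩
      δ ! ℕ.* Y ℕ.^ suc (E ∸ 1)     ≡⟨ cong (λ k → δ ! ℕ.* Y ℕ.^ k) (ℕP.suc-pred E ⦃ ℕP.m^n≢0 (δ ℕ.+ 1) (ν ℕ.+ 1) ⦄) ⟩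
      D                             ∎
    where open ≡-Reasoning

  term-𝟎 : ∀ a → term (𝟎 , a) ≡ + D ℤ.* a
  term-𝟎 a = begin
      + (vfact 𝟎 ℕ.* (δ ∸ norm 𝟎) !) ℤ.* a ℤ.* + (Y ℕ.^ (E ∸ wsum (δ ℕ.+ 1) 𝟎))
        ≡⟨ cong₂ (λ w p → + (vfact 𝟎 ℕ.* (δ ∸ w) !) ℤ.* a ℤ.* + (Y ℕ.^ (E ∸ p)))
                 (norm-replicate-0 (suc ν)) (wsum-replicate-0 (δ ℕ.+ 1) (suc ν)) ⟩
      + (vfact 𝟎 ℕ.* δ !) ℤ.* a ℤ.* + (Y ℕ.^ E)
        ≡⟨ cong (λ v → + v ℤ.* a ℤ.* + (Y ℕ.^ E))
                (trans (cong (ℕ._* δ !) (vfact-replicate-0 (suc ν))) (ℕP.*-identityˡ (δ !))) ⟩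
      + (δ !) ℤ.* a ℤ.* + (Y ℕ.^ E)
        ≡⟨ ℤ*.xy∙z≈xz∙y (+ (δ !)) a (+ (Y ℕ.^ E)) ⟩
      + (δ !) ℤ.* + (Y ℕ.^ E) ℤ.* a
        ≡⟨ cong (ℤ._* a) (sym (ℤP.pos-* (δ !) (Y ℕ.^ E))) ⟩
      + D ℤ.* a ∎
    where open ≡-Reasoning

  -- A nonconstant monomial has weighted degree wsum (δ+1) e ≥ 1, so its power of Y drops.
  ∣term∣≤K*∣a∣ : .{{_ : NonZero Y}} → ∀ e a → norm e ≤ δ → e ≢ 𝟎 → ∣ term (e , a) ∣ ≤ K ℕ.* ∣ a ∣
  ∣term∣≤K*∣a∣ e a e≤δ e≢𝟎 = begin
      ∣ term (e , a) ∣
        ≡⟨ ℤP.abs-* (+ w ℤ.* a) _ ⟩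
      ∣ + w ℤ.* a ∣ ℕ.* Y ℕ.^ (E ∸ wsum (δ ℕ.+ 1) e)
        ≡⟨ cong (ℕ._* _) (ℤP.abs-* (+ w) a) ⟩
      w ℕ.* ∣ a ∣ ℕ.* Y ℕ.^ (E ∸ wsum (δ ℕ.+ 1) e)
        ≤⟨ ℕP.*-mono-≤ (ℕP.*-monoˡ-≤ ∣ a ∣ (multinomial-weight≤ δ e e≤δ))
                       (ℕP.^-monoʳ-≤ Y (ℕP.∸-monoʳ-≤ E 1≤wsum)) ⟩
      δ ! ℕ.* ∣ a ∣ ℕ.* Y ℕ.^ (E ∸ 1)
        ≡⟨ ℕP.*-assoc (δ !) _ _ ⟩
      δ ! ℕ.* (∣ a ∣ ℕ.* Y ℕ.^ (E ∸ 1))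
        ≡⟨ cong (δ ! ℕ.*_) (ℕP.*-comm ∣ a ∣ _) ⟩
      δ ! ℕ.* (Y ℕ.^ (E ∸ 1) ℕ.* ∣ a ∣)
        ≡⟨ ℕP.*-assoc (δ !) _ _ ⟨
      K ℕ.* ∣ a ∣ ∎
    where
      open ℕP.≤-Reasoning
      w = vfact e ℕ.* (δ ∸ norm e) !
      1≤wsum : 1 ≤ wsum (δ ℕ.+ 1) e
      1≤wsum = ℕP.n≢0⇒n>0 (λ eq → e≢𝟎 (wsum≡0⇒replicate-0 (δ ℕ.+ 1) e eq))

  constant-part : Monomial ν → ℤ
  constant-part m = if does (≡-dec ℕP._≟_ 𝟎 (proj₁ m)) then proj₂ m else ℤ.0ℤ

  term-lower-bound : .{{_ : NonZero Y}} → ∀ m → norm (proj₁ m) ≤ δ →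
    + D ℤ.* constant-part m ℤ.≤ term m ℤ.+ + (K ℕ.* ∣ proj₂ m ∣)
  term-lower-bound (e , a) e≤δ with ≡-dec ℕP._≟_ 𝟎 e
  ... | yes refl = subst (ℤ._≤ term (𝟎 , a) ℤ.+ + (K ℕ.* ∣ a ∣)) (term-𝟎 a) (ℤP.i≤i+j (term (𝟎 , a)) _)
  ... | no 𝟎≢e rewrite ℤP.*-zeroʳ (+ D) =
    ∣i∣≤n⇒0≤i+n (term (e , a)) _ (∣term∣≤K*∣a∣ e a e≤δ (λ e≡𝟎 → 𝟎≢e (sym e≡𝟎)))

  coeffs-lower-bound : .{{_ : NonZero Y}} → ∀ L → All (λ m → norm (proj₁ m) ≤ δ) L →
    + D ℤ.* coeff L 𝟎 ℤ.≤ coeffs L ℤ.+ + (K ℕ.* coeffL1 L)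
  coeffs-lower-bound [] [] rewrite ℤP.*-zeroʳ (+ D) = ℤ.+≤+ z≤n
  coeffs-lower-bound (m ∷ L) (m≤δ ∷ L≤δ) = begin
      + D ℤ.* (constant-part m ℤ.+ coeff L 𝟎)
        ≡⟨ ℤP.*-distribˡ-+ (+ D) (constant-part m) _ ⟩
      + D ℤ.* constant-part m ℤ.+ + D ℤ.* coeff L 𝟎
        ≤⟨ ℤP.+-mono-≤ (term-lower-bound m m≤δ) (coeffs-lower-bound L L≤δ) ⟩
      (term m ℤ.+ + (K ℕ.* ∣ proj₂ m ∣)) ℤ.+ (coeffs L ℤ.+ + (K ℕ.* coeffL1 L))
        ≡⟨ ℤ+.interchange (term m) _ (coeffs L) _ ⟩
      (term m ℤ.+ coeffs L) ℤ.+ (+ (K ℕ.* ∣ proj₂ m ∣) ℤ.+ + (K ℕ.* coeffL1 L))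
        ≡⟨ cong (λ k → term m ℤ.+ coeffs L ℤ.+ k) (sym (ℤP.pos-+ (K ℕ.* ∣ proj₂ m ∣) _)) ⟩
      (term m ℤ.+ coeffs L) ℤ.+ + (K ℕ.* ∣ proj₂ m ∣ ℕ.+ K ℕ.* coeffL1 L)
        ≡⟨ cong (λ k → term m ℤ.+ coeffs L ℤ.+ + k) (sym (ℕP.*-distribˡ-+ K ∣ proj₂ m ∣ (coeffL1 L))) ⟩
      (term m ℤ.+ coeffs L) ℤ.+ + (K ℕ.* (∣ proj₂ m ∣ ℕ.+ coeffL1 L)) ∎
    where open ℤP.≤-Reasoning

  coeffs-nonNeg : .{{_ : NonZero Y}} → ∀ L → All (λ m → norm (proj₁ m) ≤ δ) L →
    ℤ.1ℤ ℤ.≤ coeff L 𝟎 → coeffL1 L ≤ Y → ℤ.0ℤ ℤ.≤ coeffs L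
  coeffs-nonNeg L L≤δ 1≤a₀ 𝓛≤Y = cancel (coeffs L) (begin
      + D                              ≡⟨ ℤP.*-identityʳ (+ D) ⟨
      + D ℤ.* ℤ.1ℤ                     ≤⟨ ℤP.*-monoˡ-≤-nonNeg (+ D) 1≤a₀ ⟩
      + D ℤ.* coeff L 𝟎                ≤⟨ coeffs-lower-bound L L≤δ ⟩
      coeffs L ℤ.+ + (K ℕ.* coeffL1 L) ≤⟨ ℤP.+-monoʳ-≤ (coeffs L) (ℤ.+≤+ (ℕP.*-monoʳ-≤ K 𝓛≤Y)) ⟩
      coeffs L ℤ.+ + (K ℕ.* Y)         ≡⟨ cong (λ k → coeffs L ℤ.+ + k) K*Y≡D ⟩
      coeffs L ℤ.+ + D                 ∎)
    where
      open ℤP.≤-Reasoning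
      cancel : ∀ i → + D ℤ.≤ i ℤ.+ + D → ℤ.0ℤ ℤ.≤ i
      cancel (+ n)    _ = ℤ.+≤+ z≤n
      cancel -[1+ n ] h = ⊥-elim (ℤP.<⇒≱ (ℤP.+-monoˡ-< (+ D) { -[1+ n ]} ℤ.-<+) h)

degree≤totalDegree : ∀ {ν} (L : Poly ν) → All (λ m → norm (proj₁ m) ≤ totalDegree L) L
degree≤totalDegree L = go L ℕP.≤-refl
  where
    go : ∀ {ν} (L : Poly ν) {d} → totalDegree L ≤ d → All (λ m → norm (proj₁ m) ≤ d) L
    go []      _   = []
    go (m ∷ L) L≤d = ℕP.≤-trans (ℕP.m≤m⊔n _ _) L≤d
                   ∷ go L (ℕP.≤-trans (ℕP.m≤n⊔m (norm (proj₁ m)) _) L≤d)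

module Sizes {ν} (P : Poly ν) (r a f : ℕ) where
  open Construction P r

  private instance
    β≢0 : NonZero β
    β≢0 = ℕP.m^n≢0 4 r
    𝔟^δ≢0 : NonZero (𝔟 a f ℕ.^ δ)
    𝔟^δ≢0 = ℕP.m^n≢0 (𝔟 a f) δ

  instance
    𝓑≢0 : NonZero (𝓑 a f)
    𝓑≢0 = ℕP.m*n≢0 β (𝔟 a f ℕ.^ δ)

  4≤𝔟 : 0 < f → 4 ≤ 𝔟 a f
  4≤𝔟 f>0 = s≤s (ℕP.*-mono-≤ (ℕP.*-monoʳ-≤ 3 (ℕP.m≤n+m 1 (2 ℕ.* a))) f>0)

  𝔟≤𝓑 : 0 < δ → 𝔟 a f ≤ 𝓑 a f
  𝔟≤𝓑 δ>0 = ℕP.≤-trans (m≤m^n (𝔟 a f) δ δ>0) (ℕP.m≤n*m _ β)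

  coeffL1≤𝓑 : betaBound P < β → coeffL1 P ≤ 𝓑 a f
  coeffL1≤𝓑 bound<β = begin
    coeffL1 P               ≤⟨ ℕP.m≤n*m _ (2 ℕ.* δ !) ⦃ ℕP.m*n≢0 2 (δ !) ⦃ _ ⦄ ⦃ δ ℕP.!≢0 ⦄ ⦄ ⟩
    2 ℕ.* δ ! ℕ.* coeffL1 P ≤⟨ ℕP.m≤m*n _ ((ν ℕ.+ 2) ℕ.^ δ) ⦃ ℕP.m^n≢0 (ν ℕ.+ 2) δ ⦃ ν+2≢0 ⦄ ⦄ ⟩
    betaBound P             ≤⟨ ℕP.<⇒≤ bound<β ⟩
    β                       ≤⟨ ℕP.m≤m*n β (𝔟 a f ℕ.^ δ) ⟩
    𝓑 a f                   ∎
    where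
      open ℕP.≤-Reasoning
      ν+2≢0 : NonZero (ν ℕ.+ 2)
      ν+2≢0 = ℕ.>-nonZero (ℕP.≤-trans (s≤s z≤n) (ℕP.m≤n+m 2 ν))

  4*𝓑≤N : 4 ℕ.* 𝓑 a f ≤ N a f
  4*𝓑≤N = ℕP.≤-trans (ℕP.*-monoʳ-≤ 4 (m≤m^n (𝓑 a f) ((2 ℕ.* δ ℕ.+ 1) ℕ.* (δ ℕ.+ 1) ℕ.^ ν ℕ.+ 1) (ℕP.m≤n+m 1 _)))
                     (ℕP.m≤n*m (N₁ a f) (N₀ a f) ⦃ ℕP.m^n≢0 (𝓑 a f) ((δ ℕ.+ 1) ℕ.^ ν ℕ.+ 1) ⦄)

  1≤𝓡 : ℤ.0ℤ ℤ.≤ coeffs (𝓑 a f) → ∀ g → ℤ.1ℤ ℤ.≤ 𝓡 a f g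
  1≤𝓡 coeffs≥0 g = ℤP.+-monoˡ-≤ ℤ.1ℤ {ℤ.0ℤ} {(𝓢′ ℤ.+ ℤ.1ℤ) ℤ.* + N a f ℤ.+ + 𝓣 a f}
      (0≤i+j (0≤i*j (0≤i+j (0≤i+j 𝓢≥0 0≤+n) 0≤+n) 0≤+n) 0≤+n)
    where
      𝓢′ : ℤ
      𝓢′ = 𝓢 a f g ℤ.+ + 𝓣 a f
      𝓚≥0 : ℤ.0ℤ ℤ.≤ 𝓚 a f g
      𝓚≥0 = 0≤i+j {+ (c a f g ℕ.^ δ) ℤ.* coeffs (𝓑 a f)} (0≤i*j {+ (c a f g ℕ.^ δ)} 0≤+n coeffs≥0) 0≤+n
      𝓢≥0 : ℤ.0ℤ ℤ.≤ 𝓢 a f g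
      𝓢≥0 = 0≤i+j {+ g} 0≤+n (0≤i*j {+ 2 ℤ.* 𝓚 a f g} (0≤i*j {+ 2} 0≤+n 𝓚≥0) 0≤+n)

lemma2p6 : ∀ {ν : ℕ} (P : Poly ν) → IsNormal P → SuitableForCoding P →
    ∀ (r : ℕ) → IsLeastPow4Above (betaBound P) r →
    ∀ (a f g : ℕ) → 0 < f →
      (+ (3 ℕ.* Construction.𝔟 P r a f) ℤ.≤ Construction.𝓧 P r a f g)
      × (Construction.𝔟 P r a f ⊔ 2 ℕ.^ 8 ≤ Construction.𝓨 P r a f)
lemma2p6 {ν} P _ (_ , a₀>0 , δ>0) r (bound<β , _) a f g f>0 = 3𝔟≤𝓧 , 𝔟⊔2⁸≤𝓨
  where
    open Construction P r
    open Sizes P r a f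

    4𝔟≤N : 4 ℕ.* 𝔟 a f ≤ N a f
    4𝔟≤N = ℕP.≤-trans (ℕP.*-monoʳ-≤ 4 (𝔟≤𝓑 δ>0)) 4*𝓑≤N

    16≤N : 16 ≤ N a f
    16≤N = ℕP.≤-trans (ℕP.*-monoʳ-≤ 4 (4≤𝔟 f>0)) 4𝔟≤N

    coeffs≥0 : ℤ.0ℤ ℤ.≤ coeffs (𝓑 a f)
    coeffs≥0 = Coefficients.coeffs-nonNeg ν δ (𝓑 a f) P (degree≤totalDegree P)
                 (ℤP.i<j⇒suc[i]≤j a₀>0) (coeffL1≤𝓑 bound<β)

    -- (𝔟 - 1) + 3𝔟 computes to 4𝔟 - 1 because 𝔟 is a successor.
    3𝔟≤𝓧 : + (3 ℕ.* 𝔟 a f) ℤ.≤ 𝓧 a f g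
    3𝔟≤𝓧 = begin
      + (3 ℕ.* 𝔟 a f)              ≤⟨ ℤ.+≤+ (ℕP.≤-trans (ℕP.m≤n+m _ (𝔟 a f ∸ 1)) (ℕP.∸-monoˡ-≤ 1 4𝔟≤N)) ⟩
      + (N a f ∸ 1)                ≡⟨ ℤP.*-identityʳ _ ⟨
      + (N a f ∸ 1) ℤ.* ℤ.1ℤ       ≤⟨ ℤP.*-monoˡ-≤-nonNeg (+ (N a f ∸ 1)) (1≤𝓡 coeffs≥0 g) ⟩
      + (N a f ∸ 1) ℤ.* 𝓡 a f g    ≡⟨ cong (ℤ._* 𝓡 a f g) (ℤP.⊖-≥ (ℕP.≤-trans (s≤s z≤n) 16≤N)) ⟨
      𝓧 a f g                      ∎
      where open ℤP.≤-Reasoning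

    𝔟⊔2⁸≤𝓨 : 𝔟 a f ⊔ 2 ℕ.^ 8 ≤ 𝓨 a f
    𝔟⊔2⁸≤𝓨 = ℕP.⊔-lub
      (ℕP.≤-trans (ℕP.≤-trans (ℕP.m≤n*m (𝔟 a f) 4) 4𝔟≤N) (m≤m^n (N a f) ⦃ ℕ.>-nonZero (ℕP.≤-trans (s≤s z≤n) 16≤N) ⦄ 2 (s≤s z≤n)))
      (ℕP.*-mono-≤ 16≤N (ℕP.*-mono-≤ 16≤N ℕP.≤-refl))
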